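{- If $G_1,\dots,G_k$ are QASST equivalent graphs which are pairwise not locally equivalent, and every graph QASST equivalent to them is locally equivalent to some $G_i$, then $|\mathcal{O}(G_1)|+\cdots+|\mathcal{O}(G_k)|=\Phi(G_1)$.
   Context: Local complement $c_v(G)$: replace the subgraph induced on the neighbourhood of $v$ by its complement, leaving all other edges unchanged; $\mathcal{O}(G)$ is the set of labeled graphs on the vertex set of $G$ locally equivalent to $G$. Split decomposition: the strong splits of $G$ form the edges of the strong split tree $SST(G)$; collapsing each nontrivial strong split into a pair of adjacent split-nodes yields quotient graphs containing leaf-nodes (vertices of $G$) and split-nodes. Two graphs on the same vertex set are QASST equivalent if they have the same strong split tree and corresponding quotient graphs are locally equivalent. $\Phi(G)$ denotes the number of graphs QASST equivalent to $G$. -}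

module Defs where

open import Data.Nat using (ℕ; suc; _≤_)
open import Data.Bool using (Bool; true; false; not; _∧_; _∨_; _xor_; if_then_else_)
open import Data.Bool.Properties using (∨-comm)
open import Data.Fin using (Fin; _≟_)
open import Data.Fin.Subset using (Subset; _∈_; _⊆_; ∁; _∩_; ∣_∣; Nonempty)
open import Data.Vec using (tabulate)
open import Data.List using (List; []; _∷_; length; allFin; map)
open import Data.Bool.ListAction using (any)
open import Data.Nat.ListAction using (sum)
open import Data.List.Relation.Unary.All using (All)
open import Data.List.Relation.Unary.Any using (Any)
open import Data.List.Relation.Unary.AllPairs using (AllPairs)
open import Data.Product using (Σ; _×_; ∃; _,_)
open import Data.Sum using (_⊎_)
open import Function.Bundles using (_⇔_)
open import Relation.Nullary using (¬_; yes; no)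
open import Relation.Nullary.Decidable using (⌊_⌋)
open import Relation.Binary.PropositionalEquality using (_≡_; refl; sym; cong)

record Graph (n : ℕ) : Set where
  field
    adj   : Fin n → Fin n → Bool
    adj-sym : ∀ x y → adj x y ≡ adj y x
    adj-irr : ∀ x → adj x x ≡ false
open Graph public

_≈G_ : ∀ {n} → Graph n → Graph n → Set
G ≈G H = ∀ x y → adj G x y ≡ adj H x y

_≠ᵇ_ : ∀ {n} → Fin n → Fin n → Bool
x ≠ᵇ y = not ⌊ x ≟ y ⌋

≠ᵇ-sym : ∀ {n} (x y : Fin n) → (x ≠ᵇ y) ≡ (y ≠ᵇ x)
≠ᵇ-sym x y with x ≟ y | y ≟ x
... | yes _ | yes _ = refl
... | no _  | no _  = refl
... | yes p | no q  = Data.Empty.⊥-elim (q (sym p))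
  where import Data.Empty
... | no p  | yes q = Data.Empty.⊥-elim (p (sym q))
  where import Data.Empty

≠ᵇ-irr : ∀ {n} (x : Fin n) → (x ≠ᵇ x) ≡ false
≠ᵇ-irr x with x ≟ x
... | yes _ = refl
... | no p  = Data.Empty.⊥-elim (p refl)
  where import Data.Empty

-- Local complementation c_v(G): complement the subgraph induced on N(v).

lcAdj : ∀ {n} → Fin n → Graph n → Fin n → Fin n → Bool
lcAdj v G x y = (adj G v x ∧ adj G v y ∧ (x ≠ᵇ y)) xor adj G x y

lc : ∀ {n} → Fin n → Graph n → Graph n
lc v G = record
  { adj = lcAdj v G
  ; adj-sym = λ x y → sym' x y
  ; adj-irr = λ x → irr' x
  }
  where
  sym' : ∀ x y → lcAdj v G x y ≡ lcAdj v G y x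
  sym' x y rewrite adj-sym G x y | ≠ᵇ-sym x y with adj G v x | adj G v y
  ... | true  | true  = refl
  ... | true  | false = refl
  ... | false | true  = refl
  ... | false | false = refl
  irr' : ∀ x → lcAdj v G x x ≡ false
  irr' x rewrite ≠ᵇ-irr x | adj-irr G x with adj G v x
  ... | true  = refl
  ... | false = refl

lcs : ∀ {n} → List (Fin n) → Graph n → Graph n
lcs []       G = G
lcs (v ∷ vs) G = lcs vs (lc v G)

LocEq : ∀ {n} → Graph n → Graph n → Set
LocEq G H = Σ (List (Fin _)) λ vs → lcs vs G ≈G H

-- Cardinality of a set of labeled graphs (graphs identified up to ≈G):
-- HasSize P m  means the set {H | P H} has exactly m elements.

HasSize : ∀ {n} → (Graph n → Set) → ℕ → Set
HasSize {n} P m =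
  Σ (List (Graph n)) λ L →
    (length L ≡ m)
    × AllPairs (λ H K → ¬ (H ≈G K)) L
    × All P L
    × (∀ H → P H → Any (λ K → H ≈G K) L)

OrbitSize : ∀ {n} → Graph n → ℕ → Set
OrbitSize G m = HasSize (LocEq G) m

-- A split of G is a bipartition (A, V∖A) with |A|,|V∖A| ≥ 2
-- such that the edges between A and V∖A form a complete bipartite graph
-- between the frontiers (vertices of A with a neighbour in V∖A, and
-- vice versa): whenever a–b and a'–b' are edges across, so is a–b'.

IsSplit : ∀ {n} → Graph n → Subset n → Set
IsSplit G A =
  (2 ≤ ∣ A ∣) × (2 ≤ ∣ ∁ A ∣) ×
  (∀ a a' b b' → a ∈ A → a' ∈ A → b ∈ ∁ A → b' ∈ ∁ A →
     adj G a b ≡ true → adj G a' b' ≡ true → adj G a b' ≡ true)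

Cross : ∀ {n} → Subset n → Subset n → Set
Cross A C = Nonempty (A ∩ C) × Nonempty (A ∩ ∁ C) × Nonempty (∁ A ∩ C) × Nonempty (∁ A ∩ ∁ C)

IsStrongSplit : ∀ {n} → Graph n → Subset n → Set
IsStrongSplit G A = IsSplit G A × (∀ C → IsSplit G C → ¬ Cross A C)

-- A node t is described by the
-- partition of V(G) into the leaf sets of the components of SST(G) - t,
-- given as a surjection p : Fin n → Fin m (part i = p⁻¹(i), one part per
-- edge incident with t).  Such a partition is a node iff m ≥ 3, every part
-- is a singleton (leaf edge) or one side of a strong split (tree edge),
-- and every strong split has a side contained in one part.

part : ∀ {n m} → (Fin n → Fin m) → Fin m → Subset n
part p i = tabulate (λ x → ⌊ p x ≟ i ⌋)

IsNode : ∀ {n} → Graph n → (m : ℕ) → (Fin n → Fin m) → Set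
IsNode {n} G m p =
  (3 ≤ m)
  × (∀ i → Σ (Fin n) λ x → p x ≡ i)
  × (∀ i → ∣ part p i ∣ ≡ 1 ⊎ IsStrongSplit G (part p i))
  × (∀ A → IsStrongSplit G A → Σ (Fin m) λ i → A ⊆ part p i ⊎ ∁ A ⊆ part p i)

-- The quotient graph at the node given by p: its vertices are the parts
-- (i.e. leaf-nodes and split-nodes), two of them adjacent iff G has an edge
-- between the corresponding parts.
edgeBetween : ∀ {n m} → Graph n → (Fin n → Fin m) → Fin m → Fin m → Bool
edgeBetween {n} G p i j =
  any (λ x → any (λ y → ⌊ p x ≟ i ⌋ ∧ ⌊ p y ≟ j ⌋ ∧ adj G x y) (allFin n)) (allFin n)

quotient : ∀ {n m} → Graph n → (Fin n → Fin m) → Graph m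
quotient G p = record
  { adj = qa
  ; adj-sym = qs
  ; adj-irr = qi
  }
  where
  qa : _ → _ → Bool
  qa i j = (i ≠ᵇ j) ∧ (edgeBetween G p i j ∨ edgeBetween G p j i)
  qs : ∀ i j → qa i j ≡ qa j i
  qs i j rewrite ≠ᵇ-sym i j | ∨-comm (edgeBetween G p i j) (edgeBetween G p j i) = refl
  qi : ∀ i → qa i i ≡ false
  qi i rewrite ≠ᵇ-irr i = refl

-- QASST equivalence: same strong split tree (= same set of strong splits,
-- hence the same nodes) and locally equivalent quotient graphs at every node.

QASST : ∀ {n} → Graph n → Graph n → Set
QASST G H =
  (∀ A → IsStrongSplit G A ⇔ IsStrongSplit H A)
  × (∀ m p → IsNode G m p → LocEq (quotient G p) (quotient H p))

PhiSize : ∀ {n} → Graph n → ℕ → Set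
PhiSize G m = HasSize (QASST G) m

sumFin : (k : ℕ) → (Fin k → ℕ) → ℕ
sumFin k f = sum (map f (allFin k))

-- Local complementation preserves every split: across a split (A, V∖A)
-- adjacency factors as α(a) ∧ β(b), and complementing N(v) only replaces the
-- frontier indicator on the side of v.  So locally equivalent graphs have the
-- same strong splits, hence the same nodes; at a node with partition p,
-- complementing N(v) leaves the quotient unchanged when v has no neighbour
-- outside its part, and otherwise acts on it as local complementation at the
-- part of v.  Thus each orbit O(G_i) lies in the QASST class of G_1; by
-- hypothesis these orbits are pairwise disjoint and cover that class, so
-- their sizes add up to Φ(G_1).

module Submission where

open import Defs
open import Data.Nat using (ℕ; suc; _+_; _≤_; z≤n; s≤s)
open import Data.Nat.Properties using (≤-trans; ≤-antisym; <-irrefl)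
open import Data.Bool using (Bool; true; false; not; _∧_; _∨_; _xor_)
open import Data.Bool.Properties
  using (T-≡; ∧-identityʳ; ∧-zeroʳ; ∧-assoc; ∧-distribˡ-xor; ∧-distribʳ-xor; xor-assoc; xor-same; ¬-not)
  renaming (_≟_ to _≟ᵇ_)
open import Data.Fin using (Fin; zero; _≟_)
open import Data.Fin.Properties using (any?)
open import Data.Fin.Subset using (Subset; _∈_; ∁; ∣_∣)
open import Data.Fin.Subset.Properties
  using (_∈?_; x∉p⇒x∈∁p; x∈∁p⇒x∉p; x∈⁅y⁆⇒x≡y; ∣⁅x⁆∣≡1; p⊆q⇒∣p∣≤∣q∣; x∈p∧x≢y⇒x∈p-y; x∈p⇒∣p-x∣<∣p∣)
open import Data.Vec.Properties using (lookup∘tabulate; []=⇒lookup; lookup⇒[]=)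
open import Data.List using (List; []; _∷_; _++_; [_]; length; map; concat; allFin)
open import Data.List.Properties using (length-++; length-removeAt′)
open import Data.Bool.ListAction using (any)
open import Data.Nat.ListAction using (sum)
open import Data.List.Relation.Unary.All as All using (All; []; _∷_)
import Data.List.Relation.Unary.All.Properties as All
open import Data.List.Relation.Unary.Any as Any using (Any; here; there; _─_)
import Data.List.Relation.Unary.Any.Properties as Any
open import Data.List.Relation.Unary.AllPairs as AllPairs using (AllPairs; []; _∷_)
import Data.List.Relation.Unary.AllPairs.Properties as AllPairs
open import Data.List.Relation.Unary.Unique.Propositional.Properties using (allFin⁺)
open import Data.List.Membership.Propositional using (lose)
open import Data.List.Membership.Propositional.Properties using (∈-allFin)
open import Data.Product using (Σ; ∃; _×_; _,_; proj₁; proj₂)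
open import Data.Sum using (_⊎_; inj₁; inj₂)
import Data.Sum as Sum
open import Data.Empty using (⊥; ⊥-elim)
open import Function using (_∘_)
open import Function.Bundles using (_⇔_; mk⇔; Equivalence)
open import Function.Construct.Composition using (_⇔-∘_)
open import Relation.Nullary using (¬_; Dec; yes; no)
open import Relation.Nullary.Decidable using (⌊_⌋; isYes≗does; dec-true; _×-dec_; ¬?)
open import Relation.Binary.PropositionalEquality
  using (_≡_; _≢_; refl; sym; trans; cong; cong₂; subst; module ≡-Reasoning)

open Equivalence using (to; from)

private
  variable
    n m : ℕ

Bool-ext : ∀ {a b} → (a ≡ true → b ≡ true) → (b ≡ true → a ≡ true) → a ≡ b
Bool-ext {false} {false} _ _ = refl
Bool-ext {false} {true}  _ g = g refl
Bool-ext {true}  {false} f _ = sym (f refl)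
Bool-ext {true}  {true}  _ _ = refl

Bool-ext-not : ∀ {a b} → (a ≡ true → b ≡ true → ⊥) → (b ≢ true → a ≡ true) → a ≡ not b
Bool-ext-not {false} {false} _ g = g (λ ())
Bool-ext-not {false} {true}  _ _ = refl
Bool-ext-not {true}  {false} _ _ = refl
Bool-ext-not {true}  {true}  f _ = ⊥-elim (f refl refl)

∧-true⁻ : ∀ {a b} → a ∧ b ≡ true → a ≡ true × b ≡ true
∧-true⁻ {true} {true} _ = refl , refl

∨-true⁻ : ∀ {a b} → a ∨ b ≡ true → a ≡ true ⊎ b ≡ true
∨-true⁻ {true}  _  = inj₁ refl
∨-true⁻ {false} ab = inj₂ ab

⌊⌋-sound : ∀ {A : Set} (a? : Dec A) → ⌊ a? ⌋ ≡ true → A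
⌊⌋-sound (yes a) _ = a

⌊⌋-complete : ∀ {A : Set} (a? : Dec A) → A → ⌊ a? ⌋ ≡ true
⌊⌋-complete a? a = trans (isYes≗does a?) (dec-true a? a)

≠ᵇ-true : {x y : Fin n} → x ≢ y → (x ≠ᵇ y) ≡ true
≠ᵇ-true {x = x} {y} x≢y with x ≟ y
... | yes x≡y = ⊥-elim (x≢y x≡y)
... | no _    = refl

any-allFin⁺ : (f : Fin n → Bool) (x : Fin n) → f x ≡ true → any f (allFin n) ≡ true
any-allFin⁺ f x fx = to T-≡ (Any.any⁺ f (lose (∈-allFin x) (from T-≡ fx)))

any-allFin⁻ : (f : Fin n → Bool) → any f (allFin n) ≡ true → ∃ λ x → f x ≡ true
any-allFin⁻ f h with Any.satisfied (Any.any⁻ f (allFin _) (from T-≡ h))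
... | x , fx = x , to T-≡ fx

-- Graph equality and local complementation

≈G-sym : {G H : Graph n} → G ≈G H → H ≈G G
≈G-sym G≈H x y = sym (G≈H x y)

≈G-trans : {G H K : Graph n} → G ≈G H → H ≈G K → G ≈G K
≈G-trans G≈H H≈K x y = trans (G≈H x y) (H≈K x y)

≈G-fromDistinct : (G H : Graph n) → (∀ {x y} → x ≢ y → adj G x y ≡ adj H x y) → G ≈G H
≈G-fromDistinct G H agree x y with x ≟ y
... | yes refl = trans (adj-irr G x) (sym (adj-irr H x))
... | no x≢y   = agree x≢y

module _ (v : Fin n) (G : Graph n) where

  lc-adj-centre : ∀ y → adj (lc v G) v y ≡ adj G v y
  lc-adj-centre y rewrite adj-irr G v = refl

  lc-adj-≢ : ∀ {x y} → x ≢ y → adj (lc v G) x y ≡ (adj G v x ∧ adj G v y) xor adj G x y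
  lc-adj-≢ {x} {y} x≢y rewrite ≠ᵇ-true x≢y | ∧-identityʳ (adj G v y) = refl

  lc-adj-unseenˡ : ∀ {x y} → adj G v x ≡ false → adj (lc v G) x y ≡ adj G x y
  lc-adj-unseenˡ vx rewrite vx = refl

  lc-adj-unseenʳ : ∀ {x y} → adj G v y ≡ false → adj (lc v G) x y ≡ adj G x y
  lc-adj-unseenʳ {x} vy rewrite vy | ∧-zeroʳ (adj G v x) = refl

  lc-adj-seen : ∀ {x y} → x ≢ y → adj G v x ≡ true → adj G v y ≡ true →
                adj (lc v G) x y ≡ not (adj G x y)
  lc-adj-seen x≢y vx vy rewrite lc-adj-≢ x≢y | vx | vy = refl

  lc-adj-changed : ∀ {x y} → adj (lc v G) x y ≢ adj G x y →
                   adj G v x ≡ true × adj G v y ≡ true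
  lc-adj-changed {x} {y} changed with adj G v x ≟ᵇ true | adj G v y ≟ᵇ true
  ... | yes vx | yes vy = vx , vy
  ... | no ¬vx | _      = ⊥-elim (changed (lc-adj-unseenˡ (¬-not ¬vx)))
  ... | _      | no ¬vy = ⊥-elim (changed (lc-adj-unseenʳ (¬-not ¬vy)))

  lc-involutive : lc v (lc v G) ≈G G
  lc-involutive x y rewrite lc-adj-centre x | lc-adj-centre y =
    trans (sym (xor-assoc a a (adj G x y))) (cong (_xor adj G x y) (xor-same a))
    where a = adj G v x ∧ adj G v y ∧ (x ≠ᵇ y)

lc-cong : ∀ v {G H : Graph n} → G ≈G H → lc v G ≈G lc v H
lc-cong v G≈H x y rewrite G≈H v x | G≈H v y | G≈H x y = refl

lcs-cong : ∀ vs {G H : Graph n} → G ≈G H → lcs vs G ≈G lcs vs H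
lcs-cong []       G≈H = G≈H
lcs-cong (v ∷ vs) {G} {H} G≈H = lcs-cong vs {lc v G} {lc v H} (lc-cong v {G} {H} G≈H)

lcs-++ : ∀ vs ws (G : Graph n) → lcs (vs ++ ws) G ≡ lcs ws (lcs vs G)
lcs-++ []       ws G = refl
lcs-++ (v ∷ vs) ws G = lcs-++ vs ws (lc v G)

LocEq-respʳ : {G H K : Graph n} → LocEq G H → H ≈G K → LocEq G K
LocEq-respʳ {G = G} {H} {K} (vs , G~H) H≈K = vs , ≈G-trans {G = lcs vs G} {H} {K} G~H H≈K

LocEq-trans : {G H K : Graph n} → LocEq G H → LocEq H K → LocEq G K
LocEq-trans {G = G} {H} {K} (vs , G~H) (ws , H~K) = vs ++ ws , λ x y →
  trans (cong (λ L → adj L x y) (lcs-++ vs ws G))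
        (≈G-trans {G = lcs ws (lcs vs G)} {lcs ws H} {K} (lcs-cong ws {lcs vs G} {H} G~H) H~K x y)

LocEq-lc⁻ : ∀ v (G : Graph n) → LocEq (lc v G) G
LocEq-lc⁻ v G = [ v ] , lc-involutive v G

LocEq-sym : {G H : Graph n} → LocEq G H → LocEq H G
LocEq-sym {G = G} {H} ([] , G≈H)     = [] , ≈G-sym {G = G} {H} G≈H
LocEq-sym {G = G} {H} (v ∷ vs , G~H) =
  LocEq-trans {G = H} {lc v G} {G} (LocEq-sym {G = lc v G} {H} (vs , G~H)) (LocEq-lc⁻ v G)

-- Splits

∈∁⇒≢ : {A : Subset n} {a b : Fin n} → a ∈ A → b ∈ ∁ A → a ≢ b
∈∁⇒≢ a∈A b∈∁A refl = x∈∁p⇒x∉p b∈∁A a∈A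

FrontiersComplete : Graph n → Subset n → Set
FrontiersComplete G A = ∀ a a' b b' → a ∈ A → a' ∈ A → b ∈ ∁ A → b' ∈ ∁ A →
  adj G a b ≡ true → adj G a' b' ≡ true → adj G a b' ≡ true

AdjFactorsAcross : Graph n → Subset n → (α β : Fin n → Bool) → Set
AdjFactorsAcross G A α β = ∀ {a b} → a ∈ A → b ∈ ∁ A → adj G a b ≡ α a ∧ β b

neighbourIn? : (G : Graph n) (B : Subset n) (x : Fin n) → Dec (∃ λ y → y ∈ B × adj G x y ≡ true)
neighbourIn? G B x = any? (λ y → (y ∈? B) ×-dec (adj G x y ≟ᵇ true))

hasNeighbourIn : Graph n → Subset n → Fin n → Bool
hasNeighbourIn G B x = ⌊ neighbourIn? G B x ⌋

module _ {G : Graph n} {A : Subset n} where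

  frontiersComplete⇒factors : FrontiersComplete G A →
    AdjFactorsAcross G A (hasNeighbourIn G (∁ A)) (hasNeighbourIn G A)
  frontiersComplete⇒factors complete {a} {b} a∈A b∈∁A = Bool-ext factor⇒ factor⇐
    where
    factor⇒ : adj G a b ≡ true → hasNeighbourIn G (∁ A) a ∧ hasNeighbourIn G A b ≡ true
    factor⇒ ab = cong₂ _∧_ (⌊⌋-complete (neighbourIn? G (∁ A) a) (b , b∈∁A , ab))
                           (⌊⌋-complete (neighbourIn? G A b) (a , a∈A , trans (adj-sym G b a) ab))
    factor⇐ : hasNeighbourIn G (∁ A) a ∧ hasNeighbourIn G A b ≡ true → adj G a b ≡ true
    factor⇐ h with ∧-true⁻ h
    ... | αa , βb with ⌊⌋-sound (neighbourIn? G (∁ A) a) αa | ⌊⌋-sound (neighbourIn? G A b) βb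
    ... | b' , b'∈∁A , ab' | a' , a'∈A , ba' =
      complete a a' b' b a∈A a'∈A b'∈∁A b∈∁A ab' (trans (adj-sym G a' b) ba')

  factors⇒frontiersComplete : ∀ {α β} → AdjFactorsAcross G A α β → FrontiersComplete G A
  factors⇒frontiersComplete {α} {β} factors a a' b b' a∈A a'∈A b∈∁A b'∈∁A ab a'b'
    with ∧-true⁻ {α a} {β b} (trans (sym (factors a∈A b∈∁A)) ab)
       | ∧-true⁻ {α a'} {β b'} (trans (sym (factors a'∈A b'∈∁A)) a'b')
  ... | αa , _ | _ , βb' = trans (factors a∈A b'∈∁A) (cong₂ _∧_ αa βb')

  factors-lc : ∀ v {α β} → AdjFactorsAcross G A α β →
               ∃ λ α' → ∃ λ β' → AdjFactorsAcross (lc v G) A α' β'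
  factors-lc v {α} {β} factors with v ∈? A
  ... | yes v∈A = (λ a → (adj G v a ∧ α v) xor α a) , β , λ {a} {b} a∈A b∈∁A → begin
    adj (lc v G) a b                           ≡⟨ lc-adj-≢ v G (∈∁⇒≢ a∈A b∈∁A) ⟩
    (adj G v a ∧ adj G v b) xor adj G a b      ≡⟨ cong₂ (λ s t → (adj G v a ∧ s) xor t)
                                                        (factors v∈A b∈∁A) (factors a∈A b∈∁A) ⟩
    (adj G v a ∧ (α v ∧ β b)) xor (α a ∧ β b)  ≡⟨ cong (_xor (α a ∧ β b)) (sym (∧-assoc (adj G v a) (α v) (β b))) ⟩
    ((adj G v a ∧ α v) ∧ β b) xor (α a ∧ β b)  ≡⟨ sym (∧-distribʳ-xor (β b) (adj G v a ∧ α v) (α a)) ⟩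
    ((adj G v a ∧ α v) xor α a) ∧ β b          ∎
    where open ≡-Reasoning
  ... | no v∉A = α , (λ b → (β v ∧ adj G v b) xor β b) , λ {a} {b} a∈A b∈∁A → begin
    adj (lc v G) a b                           ≡⟨ lc-adj-≢ v G (∈∁⇒≢ a∈A b∈∁A) ⟩
    (adj G v a ∧ adj G v b) xor adj G a b      ≡⟨ cong₂ (λ s t → (s ∧ adj G v b) xor t)
                                                        (trans (adj-sym G v a) (factors a∈A (x∉p⇒x∈∁p v∉A)))
                                                        (factors a∈A b∈∁A) ⟩
    ((α a ∧ β v) ∧ adj G v b) xor (α a ∧ β b)  ≡⟨ cong (_xor (α a ∧ β b)) (∧-assoc (α a) (β v) (adj G v b)) ⟩
    (α a ∧ (β v ∧ adj G v b)) xor (α a ∧ β b)  ≡⟨ sym (∧-distribˡ-xor (α a) (β v ∧ adj G v b) (β b)) ⟩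
    α a ∧ ((β v ∧ adj G v b) xor β b)          ∎
    where open ≡-Reasoning

frontiersComplete-lc : ∀ v {G : Graph n} {A} → FrontiersComplete G A → FrontiersComplete (lc v G) A
frontiersComplete-lc v {G} {A} complete
  with factors-lc {G = G} {A} v {hasNeighbourIn G (∁ A)} {hasNeighbourIn G A}
                  (frontiersComplete⇒factors {G = G} {A} complete)
... | α , β , factors = factors⇒frontiersComplete {G = lc v G} {A} {α} {β} factors

IsSplit-lc : ∀ v {G : Graph n} {A} → IsSplit G A → IsSplit (lc v G) A
IsSplit-lc v {G} {A} (2≤∣A∣ , 2≤∣∁A∣ , complete) =
  2≤∣A∣ , 2≤∣∁A∣ , frontiersComplete-lc v {G} {A} complete

IsSplit-≈ : {G H : Graph n} → G ≈G H → ∀ {A} → IsSplit G A → IsSplit H A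
IsSplit-≈ G≈H {A} (2≤∣A∣ , 2≤∣∁A∣ , complete) = 2≤∣A∣ , 2≤∣∁A∣ ,
  λ a a' b b' a∈A a'∈A b∈∁A b'∈∁A ab a'b' → trans (sym (G≈H a b'))
    (complete a a' b b' a∈A a'∈A b∈∁A b'∈∁A (trans (G≈H a b) ab) (trans (G≈H a' b') a'b'))

IsSplit-lc⁻ : ∀ v {G : Graph n} {A} → IsSplit (lc v G) A → IsSplit G A
IsSplit-lc⁻ v {G} {A} split =
  IsSplit-≈ {G = lc v (lc v G)} {G} (lc-involutive v G) {A} (IsSplit-lc v {lc v G} {A} split)

sameSplits⇒sameStrongSplits : {G H : Graph n} → (∀ A → IsSplit G A ⇔ IsSplit H A) →
                              ∀ A → IsStrongSplit G A ⇔ IsStrongSplit H A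
sameSplits⇒sameStrongSplits same A =
  mk⇔ (λ (split , uncrossed) → to (same A) split , λ C → uncrossed C ∘ from (same C))
      (λ (split , uncrossed) → from (same A) split , λ C → uncrossed C ∘ to (same C))

-- Nodes and quotient graphs

∈-part : (p : Fin n → Fin m) {x : Fin n} {i : Fin m} → p x ≡ i → x ∈ part p i
∈-part p {x} {i} px≡i = lookup⇒[]= x (part p i)
  (trans (lookup∘tabulate (λ z → ⌊ p z ≟ i ⌋) x) (⌊⌋-complete (p x ≟ i) px≡i))

∈-part⁻ : (p : Fin n → Fin m) {x : Fin n} {i : Fin m} → x ∈ part p i → p x ≡ i
∈-part⁻ p {x} {i} x∈Pi =
  ⌊⌋-sound (p x ≟ i) (trans (sym (lookup∘tabulate (λ z → ⌊ p z ≟ i ⌋) x)) ([]=⇒lookup x∈Pi))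

∈-∁part : (p : Fin n → Fin m) {x : Fin n} {i : Fin m} → p x ≢ i → x ∈ ∁ (part p i)
∈-∁part p px≢i = x∉p⇒x∈∁p (px≢i ∘ ∈-part⁻ p)

x∈p⇒1≤∣p∣ : {P : Subset n} {x : Fin n} → x ∈ P → 1 ≤ ∣ P ∣
x∈p⇒1≤∣p∣ {x = x} x∈P = subst (_≤ _) (∣⁅x⁆∣≡1 x)
  (p⊆q⇒∣p∣≤∣q∣ λ y∈⁅x⁆ → subst (_∈ _) (sym (x∈⁅y⁆⇒x≡y x y∈⁅x⁆)) x∈P)

x∈p∧y∈p∧x≢y⇒2≤∣p∣ : {P : Subset n} {x y : Fin n} → x ∈ P → y ∈ P → x ≢ y → 2 ≤ ∣ P ∣
x∈p∧y∈p∧x≢y⇒2≤∣p∣ x∈P y∈P x≢y =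
  ≤-trans (s≤s (x∈p⇒1≤∣p∣ (x∈p∧x≢y⇒x∈p-y y∈P (x≢y ∘ sym)))) (x∈p⇒∣p-x∣<∣p∣ x∈P)

PartsFrontiersComplete : Graph n → (Fin n → Fin m) → Set
PartsFrontiersComplete G p = ∀ {i x x' y y'} → p x ≡ i → p x' ≡ i → p y ≢ i → p y' ≢ i →
  adj G x y ≡ true → adj G x' y' ≡ true → adj G x y' ≡ true

IsNode⇒partsFrontiersComplete : {G : Graph n} {p : Fin n → Fin m} →
                                IsNode G m p → PartsFrontiersComplete G p
IsNode⇒partsFrontiersComplete {p = p} (_ , _ , parts , _) {i} {x} {x'} {y} {y'} px px' py py' xy x'y'
  with parts i
... | inj₂ ((_ , _ , complete) , _) =
  complete x x' y y' (∈-part p px) (∈-part p px') (∈-∁part p py) (∈-∁part p py') xy x'y'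
... | inj₁ ∣Pi∣≡1 with x ≟ x'
...   | yes refl = x'y'
...   | no x≢x'  = ⊥-elim (<-irrefl refl
          (subst (2 ≤_) ∣Pi∣≡1 (x∈p∧y∈p∧x≢y⇒2≤∣p∣ (∈-part p px) (∈-part p px') x≢x')))

module _ (p : Fin n → Fin m) {i j : Fin m} (i≢j : i ≢ j) where

  outsideˡ : ∀ {x} → p x ≡ i → p x ≢ j
  outsideˡ px px≡j = i≢j (trans (sym px) px≡j)

  outsideʳ : ∀ {y} → p y ≡ j → p y ≢ i
  outsideʳ py py≡i = i≢j (trans (sym py≡i) py)

  distinctParts : ∀ {x y} → p x ≡ i → p y ≡ j → x ≢ y
  distinctParts px py refl = i≢j (trans (sym px) py)

Joined : Graph n → (Fin n → Fin m) → Fin m → Fin m → Set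
Joined {n} G p i j = Σ (Fin n) λ x → Σ (Fin n) λ y → p x ≡ i × p y ≡ j × adj G x y ≡ true

module _ {G : Graph n} {p : Fin n → Fin m} where

  Joined-sym : ∀ {i j} → Joined G p i j → Joined G p j i
  Joined-sym (x , y , px , py , xy) = y , x , py , px , trans (adj-sym G y x) xy

  edgeBetween⇔Joined : ∀ {i j} → edgeBetween G p i j ≡ true ⇔ Joined G p i j
  edgeBetween⇔Joined {i} {j} = mk⇔ joined joined⁻
    where
    joined : edgeBetween G p i j ≡ true → Joined G p i j
    joined h with any-allFin⁻ _ h
    ... | x , h′ with any-allFin⁻ _ h′
    ... | y , h″ with ∧-true⁻ {⌊ p x ≟ i ⌋} h″
    ... | px , h‴ with ∧-true⁻ {⌊ p y ≟ j ⌋} h‴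
    ... | py , xy = x , y , ⌊⌋-sound (p x ≟ i) px , ⌊⌋-sound (p y ≟ j) py , xy
    joined⁻ : Joined G p i j → edgeBetween G p i j ≡ true
    joined⁻ (x , y , px , py , xy) = any-allFin⁺ _ x (any-allFin⁺ _ y
      (cong₂ _∧_ (⌊⌋-complete (p x ≟ i) px) (cong₂ _∧_ (⌊⌋-complete (p y ≟ j) py) xy)))

  quotient-adj⇔Joined : ∀ {i j} → i ≢ j → adj (quotient G p) i j ≡ true ⇔ Joined G p i j
  quotient-adj⇔Joined {i} {j} i≢j = mk⇔ joined joined⁻
    where
    adj≡ : adj (quotient G p) i j ≡ edgeBetween G p i j ∨ edgeBetween G p j i
    adj≡ = cong (_∧ (edgeBetween G p i j ∨ edgeBetween G p j i)) (≠ᵇ-true i≢j)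
    joined : adj (quotient G p) i j ≡ true → Joined G p i j
    joined h with ∨-true⁻ {edgeBetween G p i j} (trans (sym adj≡) h)
    ... | inj₁ eij = to edgeBetween⇔Joined eij
    ... | inj₂ eji = Joined-sym (to edgeBetween⇔Joined eji)
    joined⁻ : Joined G p i j → adj (quotient G p) i j ≡ true
    joined⁻ J = trans adj≡ (cong (_∨ edgeBetween G p j i) (from edgeBetween⇔Joined J))

Joined-≈ : {G H : Graph n} {p : Fin n → Fin m} {i j : Fin m} → G ≈G H → Joined G p i j → Joined H p i j
Joined-≈ G≈H (x , y , px , py , xy) = x , y , px , py , trans (sym (G≈H x y)) xy

quotient-adj-cong : {G H : Graph n} {p : Fin n → Fin m} {i j : Fin m} → i ≢ j →
  (Joined G p i j → Joined H p i j) → (Joined H p i j → Joined G p i j) →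
  adj (quotient G p) i j ≡ adj (quotient H p) i j
quotient-adj-cong {G = G} {H} {p} i≢j G⇒H H⇒G = Bool-ext
  (from (quotient-adj⇔Joined {G = H} {p} i≢j) ∘ G⇒H ∘ to (quotient-adj⇔Joined {G = G} {p} i≢j))
  (from (quotient-adj⇔Joined {G = G} {p} i≢j) ∘ H⇒G ∘ to (quotient-adj⇔Joined {G = H} {p} i≢j))

quotient-≈ : {G H : Graph n} (p : Fin n → Fin m) → G ≈G H → quotient G p ≈G quotient H p
quotient-≈ {G = G} {H} p G≈H = ≈G-fromDistinct (quotient G p) (quotient H p) λ i≢j →
  quotient-adj-cong {G = G} {H} {p} i≢j (Joined-≈ {G = G} {H} G≈H) (Joined-≈ {G = H} {G} (≈G-sym {G = G} {H} G≈H))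

-- Local complementation seen from a node

Sees : Graph n → (Fin n → Fin m) → Fin n → Fin m → Set
Sees {n} G p v i = Σ (Fin n) λ y → p y ≡ i × adj G v y ≡ true

SeesOutside : Graph n → (Fin n → Fin m) → Fin n → Set
SeesOutside {n} G p v = Σ (Fin n) λ w → p w ≢ p v × adj G v w ≡ true

module _ (v : Fin n) (G : Graph n) (p : Fin n → Fin m) where

  sees? : ∀ i → Dec (Sees G p v i)
  sees? i = any? λ y → (p y ≟ i) ×-dec (adj G v y ≟ᵇ true)

  seesOutside? : Dec (SeesOutside G p v)
  seesOutside? = any? λ w → ¬? (p w ≟ p v) ×-dec (adj G v w ≟ᵇ true)

  Sees⇒Joined-centre : ∀ {i} → Sees G p v i → Joined G p (p v) i
  Sees⇒Joined-centre (y , py , vy) = v , y , refl , py , vy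

  Sees-lc⁻ : ∀ {i} → Sees (lc v G) p v i → Sees G p v i
  Sees-lc⁻ (y , py , vy) = y , py , trans (sym (lc-adj-centre v G y)) vy

  -- Edges at v are not changed, so v itself witnesses any edge that was removed.
  Joined-lc-centre : ∀ {j} → Joined G p (p v) j → Joined (lc v G) p (p v) j
  Joined-lc-centre (x , y , px , py , xy) with adj (lc v G) x y ≟ᵇ true
  ... | yes xy′ = x , y , px , py , xy′
  ... | no ¬xy′ = v , y , refl , py ,
    trans (lc-adj-centre v G y) (proj₂ (lc-adj-changed v G λ same → ¬xy′ (trans same xy)))

  Joined-lc-unseen : ∀ {i j} → ¬ Sees G p v i → Joined G p i j → Joined (lc v G) p i j
  Joined-lc-unseen unseen (x , y , px , py , xy) =
    x , y , px , py , trans (lc-adj-unseenˡ v G (¬-not λ vx → unseen (x , px , vx))) xy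

module _ (v : Fin n) (G : Graph n) (p : Fin n → Fin m) where

  Joined-lc-centre⁻ : ∀ {j} → Joined (lc v G) p (p v) j → Joined G p (p v) j
  Joined-lc-centre⁻ = Joined-≈ {G = lc v (lc v G)} {G} (lc-involutive v G) ∘ Joined-lc-centre v (lc v G) p

  Joined-lc-unseen⁻ : ∀ {i j} → ¬ Sees G p v i → Joined (lc v G) p i j → Joined G p i j
  Joined-lc-unseen⁻ unseen = Joined-≈ {G = lc v (lc v G)} {G} (lc-involutive v G)
                           ∘ Joined-lc-unseen v (lc v G) p (unseen ∘ Sees-lc⁻ v G p)

module _ {G : Graph n} {p : Fin n → Fin m} (complete : PartsFrontiersComplete G p) (v : Fin n) where

  sees-frontier : ∀ {i x y} → p v ≢ i → Sees G p v i → p x ≡ i → p y ≢ i →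
                  adj G x y ≡ true → adj G v x ≡ true
  sees-frontier {x = x} pv≢i (s , ps , vs) px py xy =
    trans (adj-sym G v x) (complete px ps py pv≢i xy (trans (adj-sym G s v) vs))

  Joined⇒adj : ∀ {i j x y} → i ≢ j → p v ≢ i → p v ≢ j → Joined G p i j →
               p x ≡ i → p y ≡ j → adj G v x ≡ true → adj G v y ≡ true → adj G x y ≡ true
  Joined⇒adj {x = x} {y} i≢j pv≢i pv≢j (x₀ , y₀ , px₀ , py₀ , x₀y₀) px py vx vy =
    trans (adj-sym G x y) (complete py py₀ pv≢j (outsideˡ p i≢j px)
      (trans (adj-sym G y v) vy)
      (trans (adj-sym G y₀ x) (complete px px₀ pv≢i (outsideʳ p i≢j py₀)
        (trans (adj-sym G x v) vx) x₀y₀)))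

  Joined-centre⇒Sees : ∀ {i} → SeesOutside G p v → p v ≢ i → Joined G p (p v) i → Sees G p v i
  Joined-centre⇒Sees (w , pw , vw) pv≢i (x , y , px , py , xy) =
    y , py , complete refl px pw (outsideʳ p pv≢i py) vw xy

  lc-adj⇒seenEnds : ∀ {i j x y} → i ≢ j → p v ≢ i → p v ≢ j → Sees G p v i → Sees G p v j →
                    p x ≡ i → p y ≡ j → adj (lc v G) x y ≡ true → adj G v x ≡ true × adj G v y ≡ true
  lc-adj⇒seenEnds {x = x} {y} i≢j pv≢i pv≢j seesI seesJ px py xy′ with adj G x y ≟ᵇ true
  ... | yes xy = sees-frontier pv≢i seesI px (outsideʳ p i≢j py) xy
               , sees-frontier pv≢j seesJ py (outsideˡ p i≢j px) (trans (adj-sym G y x) xy)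
  ... | no ¬xy = lc-adj-changed v G λ same → ¬xy (trans (sym same) xy′)

  -- v is adjacent to the whole frontier of both parts, so every edge between them is toggled.
  Joined-lc-seen : ∀ {i j} → i ≢ j → p v ≢ i → p v ≢ j → Sees G p v i → Sees G p v j →
                   Joined (lc v G) p i j → ¬ Joined G p i j
  Joined-lc-seen i≢j pv≢i pv≢j seesI seesJ (x , y , px , py , xy′) joined
    with lc-adj⇒seenEnds i≢j pv≢i pv≢j seesI seesJ px py xy′
  ... | vx , vy with begin
      true              ≡⟨ sym xy′ ⟩
      adj (lc v G) x y  ≡⟨ lc-adj-seen v G (distinctParts p i≢j px py) vx vy ⟩
      not (adj G x y)   ≡⟨ cong not (Joined⇒adj i≢j pv≢i pv≢j joined px py vx vy) ⟩
      false             ∎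
    where open ≡-Reasoning
  ... | ()

  Joined-lc-seen⁻ : ∀ {i j} → i ≢ j → Sees G p v i → Sees G p v j →
                    ¬ Joined G p i j → Joined (lc v G) p i j
  Joined-lc-seen⁻ i≢j (s , ps , vs) (t , pt , vt) unjoined = s , t , ps , pt ,
    trans (lc-adj-seen v G (distinctParts p i≢j ps pt) vs vt)
          (cong not (¬-not λ st → unjoined (s , t , ps , pt , st)))

  private
    c  = p v
    Q  = quotient G p
    Q′ = quotient (lc v G) p

    Q-adj⇔Joined : ∀ {i j} → i ≢ j → adj Q i j ≡ true ⇔ Joined G p i j
    Q-adj⇔Joined = quotient-adj⇔Joined {G = G} {p}

    quotient-lc-centre : ∀ {j} → c ≢ j → adj Q′ c j ≡ adj Q c j
    quotient-lc-centre c≢j = quotient-adj-cong {G = lc v G} {G} {p} c≢j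
      (Joined-lc-centre⁻ v G p) (Joined-lc-centre v G p)

    quotient-lc-unseen : ∀ {i j} → i ≢ j → ¬ Sees G p v i → adj Q′ i j ≡ adj Q i j
    quotient-lc-unseen i≢j unseen = quotient-adj-cong {G = lc v G} {G} {p} i≢j
      (Joined-lc-unseen⁻ v G p unseen) (Joined-lc-unseen v G p unseen)

    quotient-lc-seen : ∀ {i j} → i ≢ j → c ≢ i → c ≢ j → Sees G p v i → Sees G p v j →
                       adj Q′ i j ≡ not (adj Q i j)
    quotient-lc-seen i≢j c≢i c≢j seesI seesJ = Bool-ext-not
      (λ q′ q → Joined-lc-seen i≢j c≢i c≢j seesI seesJ
                  (to (quotient-adj⇔Joined {G = lc v G} {p} i≢j) q′) (to (Q-adj⇔Joined i≢j) q))
      (λ ¬q → from (quotient-adj⇔Joined {G = lc v G} {p} i≢j)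
                (Joined-lc-seen⁻ i≢j seesI seesJ (¬q ∘ from (Q-adj⇔Joined i≢j))))

  quotient-lc-inside : ¬ SeesOutside G p v → Q′ ≈G Q
  quotient-lc-inside inside = ≈G-fromDistinct Q′ Q λ {i} i≢j → agree-by i≢j (c ≟ i)
    where
    agree-by : ∀ {i j} → i ≢ j → Dec (c ≡ i) → adj Q′ i j ≡ adj Q i j
    agree-by i≢j (yes refl) = quotient-lc-centre i≢j
    agree-by {i} i≢j (no c≢i) = quotient-lc-unseen i≢j λ (y , py , vy) →
      inside (y , outsideʳ p c≢i py , vy)

  -- The parts seen from v are then exactly the neighbours of c in Q.
  quotient-lc-outside : SeesOutside G p v → Q′ ≈G lc c Q
  quotient-lc-outside outside =
    ≈G-fromDistinct Q′ (lc c Q) λ {i} {j} i≢j → agree-by i≢j (c ≟ i) (c ≟ j)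
    where
    Q-adj-centre : ∀ {i} → c ≢ i → ¬ Sees G p v i → adj Q c i ≡ false
    Q-adj-centre c≢i unseen =
      ¬-not (unseen ∘ Joined-centre⇒Sees outside c≢i ∘ to (Q-adj⇔Joined c≢i))
    Q-adj-centre⁻ : ∀ {i} → c ≢ i → Sees G p v i → adj Q c i ≡ true
    Q-adj-centre⁻ c≢i = from (Q-adj⇔Joined c≢i) ∘ Sees⇒Joined-centre v G p
    agree-centre : ∀ {j} → c ≢ j → adj Q′ c j ≡ adj (lc c Q) c j
    agree-centre c≢j = trans (quotient-lc-centre c≢j) (sym (lc-adj-unseenˡ c Q (adj-irr Q c)))
    agree-by : ∀ {i j} → i ≢ j → Dec (c ≡ i) → Dec (c ≡ j) → adj Q′ i j ≡ adj (lc c Q) i j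
    agree-by i≢j (yes refl) _ = agree-centre i≢j
    agree-by {i} i≢j (no _) (yes refl) =
      trans (adj-sym Q′ i c) (trans (agree-centre (i≢j ∘ sym)) (adj-sym (lc c Q) c i))
    agree-by {i} {j} i≢j (no c≢i) (no c≢j) with sees? v G p i | sees? v G p j
    ... | no unseenI | _ = trans (quotient-lc-unseen i≢j unseenI)
                                 (sym (lc-adj-unseenˡ c Q (Q-adj-centre c≢i unseenI)))
    ... | yes _ | no unseenJ =
      trans (adj-sym Q′ i j) (trans (quotient-lc-unseen (i≢j ∘ sym) unseenJ)
        (trans (adj-sym Q j i) (sym (lc-adj-unseenʳ c Q (Q-adj-centre c≢j unseenJ)))))
    ... | yes seesI | yes seesJ = trans (quotient-lc-seen i≢j c≢i c≢j seesI seesJ)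
      (sym (lc-adj-seen c Q i≢j (Q-adj-centre⁻ c≢i seesI) (Q-adj-centre⁻ c≢j seesJ)))

  LocEq-quotient-lc : LocEq (quotient G p) (quotient (lc v G) p)
  LocEq-quotient-lc with seesOutside? v G p
  ... | yes outside = [ c ] , ≈G-sym {G = Q′} {lc c Q} (quotient-lc-outside outside)
  ... | no inside   = []    , ≈G-sym {G = Q′} {Q} (quotient-lc-inside inside)

-- QASST equivalence

IsNode-transfer : {G H : Graph n} → (∀ A → IsStrongSplit G A ⇔ IsStrongSplit H A) →
                  ∀ {m p} → IsNode G m p → IsNode H m p
IsNode-transfer same (3≤m , onto , parts , covered) =
  3≤m , onto , (λ i → Sum.map₂ (to (same _)) (parts i)) , λ A → covered A ∘ from (same A)

QASST-trans : {G H K : Graph n} → QASST G H → QASST H K → QASST G K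
QASST-trans {G = G} {H} {K} (sameGH , quotGH) (sameHK , quotHK) =
  (λ A → sameHK A ⇔-∘ sameGH A) ,
  λ m p node → LocEq-trans {G = quotient G p} {quotient H p} {quotient K p}
                 (quotGH m p node) (quotHK m p (IsNode-transfer {G = G} {H} sameGH node))

QASST-≈ : {G H : Graph n} → G ≈G H → QASST G H
QASST-≈ {G = G} {H} G≈H =
  sameSplits⇒sameStrongSplits {G = G} {H}
    (λ A → mk⇔ (IsSplit-≈ {G = G} {H} G≈H) (IsSplit-≈ {G = H} {G} (≈G-sym {G = G} {H} G≈H))) ,
  λ m p _ → [] , quotient-≈ {G = G} {H} p G≈H

QASST-lc : ∀ v (G : Graph n) → QASST G (lc v G)
QASST-lc v G =
  sameSplits⇒sameStrongSplits {G = G} {lc v G} (λ A → mk⇔ (IsSplit-lc v {G} {A}) (IsSplit-lc⁻ v {G} {A})) ,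
  λ m p node → LocEq-quotient-lc (IsNode⇒partsFrontiersComplete {G = G} {p} node) v

LocEq⇒QASST : {G H : Graph n} → LocEq G H → QASST G H
LocEq⇒QASST {G = G} {H} ([] , G≈H)     = QASST-≈ {G = G} {H} G≈H
LocEq⇒QASST {G = G} {H} (v ∷ vs , G~H) =
  QASST-trans {G = G} {lc v G} {H} (QASST-lc v G) (LocEq⇒QASST {G = lc v G} {H} (vs , G~H))

-- Counting up to equality of graphs

Any-─ : {G H : Graph n} {Ks : List (Graph n)} (G∈Ks : Any (G ≈G_) Ks) →
        Any (H ≈G_) Ks → ¬ G ≈G H → Any (H ≈G_) (Ks ─ G∈Ks)
Any-─ {G = G} {H} {K ∷ _} (here G≈K) (here H≈K) G≉H =
  ⊥-elim (G≉H (≈G-trans {G = G} {K} {H} G≈K (≈G-sym {G = H} {K} H≈K)))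
Any-─ (here _)     (there H∈Ks) _   = H∈Ks
Any-─ (there _)    (here H≈K)   _   = here H≈K
Any-─ {G = G} {H} (there G∈Ks) (there H∈Ks) G≉H = there (Any-─ {G = G} {H} G∈Ks H∈Ks G≉H)

distinct∧covered⇒length≤ : {Gs Ks : List (Graph n)} → AllPairs (λ G H → ¬ G ≈G H) Gs →
                           All (λ G → Any (G ≈G_) Ks) Gs → length Gs ≤ length Ks
distinct∧covered⇒length≤ [] [] = z≤n
distinct∧covered⇒length≤ {Gs = G ∷ _} {Ks} (G≉Gs ∷ distinct) (G∈Ks ∷ Gs⊆Ks) =
  subst (_ ≤_) (sym (length-removeAt′ Ks (Any.index G∈Ks)))
    (s≤s (distinct∧covered⇒length≤ distinct
      (All.zipWith (λ {H} (H∈Ks , G≉H) → Any-─ {G = G} {H} G∈Ks H∈Ks G≉H) (Gs⊆Ks , G≉Gs))))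

HasSize-unique : {P : Graph n → Set} {k l : ℕ} → HasSize P k → HasSize P l → k ≡ l
HasSize-unique (Gs , refl , distinctGs , PGs , coveredByGs) (Hs , refl , distinctHs , PHs , coveredByHs) =
  ≤-antisym (distinct∧covered⇒length≤ distinctGs (All.map (λ {G} → coveredByHs G) PGs))
            (distinct∧covered⇒length≤ distinctHs (All.map (λ {H} → coveredByGs H) PHs))

HasSize-⇔ : {P Q : Graph n → Set} {k : ℕ} → (∀ G → P G ⇔ Q G) → HasSize P k → HasSize Q k
HasSize-⇔ P⇔Q (Gs , length≡ , distinct , PGs , covered) =
  Gs , length≡ , distinct , All.map (λ {G} → to (P⇔Q G)) PGs , λ G → covered G ∘ from (P⇔Q G)

HasSize-⋃ : {k : ℕ} {P : Fin k → Graph n → Set} {o : Fin k → ℕ} →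
            (∀ {i j} G H → P i G → P j H → G ≈G H → i ≡ j) →
            (∀ i → HasSize (P i) (o i)) →
            HasSize (λ G → Σ (Fin k) λ i → P i G) (sumFin k o)
HasSize-⋃ {n} {k} {P} {o} disjoint sizes =
  concat (map class (allFin k)) , length-classes (allFin k) , distinct , members , covered
  where
  class : Fin k → List (Graph n)
  class i = proj₁ (sizes i)
  class-length : ∀ i → length (class i) ≡ o i
  class-length i = proj₁ (proj₂ (sizes i))
  class-distinct : ∀ i → AllPairs (λ G H → ¬ G ≈G H) (class i)
  class-distinct i = proj₁ (proj₂ (proj₂ (sizes i)))
  class-members : ∀ i → All (P i) (class i)
  class-members i = proj₁ (proj₂ (proj₂ (proj₂ (sizes i))))
  class-covers : ∀ i G → P i G → Any (G ≈G_) (class i)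
  class-covers i = proj₂ (proj₂ (proj₂ (proj₂ (sizes i))))

  length-classes : ∀ is → length (concat (map class is)) ≡ sum (map o is)
  length-classes []       = refl
  length-classes (i ∷ is) =
    trans (length-++ (class i)) (cong₂ _+_ (class-length i) (length-classes is))

  separated : ∀ {i j} → i ≢ j → All (λ G → All (λ H → ¬ G ≈G H) (class j)) (class i)
  separated i≢j = All.map (λ {G} PiG → All.map (λ {H} PjH G≈H → i≢j (disjoint G H PiG PjH G≈H))
                                                (class-members _))
                          (class-members _)

  distinct : AllPairs (λ G H → ¬ G ≈G H) (concat (map class (allFin k)))
  distinct = AllPairs.concat⁺ (All.map⁺ (All.tabulate λ {i} _ → class-distinct i))
                              (AllPairs.map⁺ (AllPairs.map separated (allFin⁺ k)))

  members : All (λ G → Σ (Fin k) λ i → P i G) (concat (map class (allFin k)))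
  members = All.concat⁺ {xss = map class (allFin k)}
              (All.map⁺ (All.tabulate λ {i} _ → All.map (i ,_) (class-members i)))

  covered : ∀ G → Σ (Fin k) (λ i → P i G) → Any (G ≈G_) (concat (map class (allFin k)))
  covered G (i , PiG) = Any.concat⁺ (Any.map⁺ (lose (∈-allFin i) (class-covers i G PiG)))

corollary3 : (n k : ℕ) (Gs : Fin (suc k) → Graph n)
    → (∀ i j → QASST (Gs i) (Gs j))
    → (∀ i j → ¬ (i ≡ j) → ¬ LocEq (Gs i) (Gs j))
    → (∀ H → QASST (Gs zero) H → Σ (Fin (suc k)) λ i → LocEq (Gs i) H)
    → (o : Fin (suc k) → ℕ) → (∀ i → OrbitSize (Gs i) (o i))
    → (φ : ℕ) → PhiSize (Gs zero) φ
    → sumFin (suc k) o ≡ φ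
corollary3 n k Gs qasst separated covered o orbits φ phi =
  HasSize-unique (HasSize-⇔ classes (HasSize-⋃ {P = LocEq ∘ Gs} disjoint orbits)) phi
  where
  classes : ∀ H → (Σ (Fin (suc k)) λ i → LocEq (Gs i) H) ⇔ QASST (Gs zero) H
  classes H = mk⇔ (λ (i , Gi~H) → QASST-trans {G = Gs zero} {Gs i} {H} (qasst zero i)
                                     (LocEq⇒QASST {G = Gs i} {H} Gi~H))
                  (covered H)
  disjoint : ∀ {i j} G H → LocEq (Gs i) G → LocEq (Gs j) H → G ≈G H → i ≡ j
  disjoint {i} {j} G H Gi~G Gj~H G≈H with i ≟ j
  ... | yes i≡j = i≡j
  ... | no i≢j  = ⊥-elim (separated i j i≢j
    (LocEq-trans {G = Gs i} {H} {Gs j} (LocEq-respʳ {G = Gs i} {G} {H} Gi~G G≈H) (LocEq-sym {G = Gs j} {H} Gj~H)))
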